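{- For every integer $n\ge2$, $B'(K_n)=\lfloor n^2/4\rfloor+\lceil n/2\rceil-2$.
   Context: $K_n$ is the complete graph on $n$ vertices. An edge-numbering of a graph $G$ is an assignment $f$ of distinct integers to the edges; $B'(f)$ is the maximum of $|f(e)-f(e')|$ over pairs of distinct incident edges $e,e'$. The edge-bandwidth $B'(G)$ is the minimum of $B'(f)$ over all edge-numberings $f$ of $G$. -}

module Defs where

open import Data.Nat using (ℕ; _<_; _≤_; _+_; _*_; _∸_; _/_)
open import Data.Integer using (ℤ; ∣_∣; _-_)
open import Data.Fin using (Fin; toℕ)
open import Data.Product using (Σ; _×_; _,_; proj₁; proj₂; ∃)
open import Relation.Binary.PropositionalEquality using (_≡_)
open import Relation.Nullary using (¬_)
open import Data.Sum using (_⊎_)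

-- An edge of the complete graph K_n on vertex set Fin n:
-- an unordered pair {i, j} with i ≠ j, represented canonically as i < j.
Edge : ℕ → Set
Edge n = Σ (Fin n) λ i → Σ (Fin n) λ j → toℕ i < toℕ j

src : ∀ {n} → Edge n → Fin n
src e = proj₁ e

tgt : ∀ {n} → Edge n → Fin n
tgt e = proj₁ (proj₂ e)

SameEdge : ∀ {n} → Edge n → Edge n → Set
SameEdge e e' = (src e ≡ src e') × (tgt e ≡ tgt e')

HasEnd : ∀ {n} → Edge n → Fin n → Set
HasEnd e v = (src e ≡ v) ⊎ (tgt e ≡ v)

Incident : ∀ {n} → Edge n → Edge n → Set
Incident e e' = ¬ SameEdge e e' × ∃ λ v → HasEnd e v × HasEnd e' v

IsEdgeNumbering : ∀ {n} → (Edge n → ℤ) → Set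
IsEdgeNumbering {n} f = ∀ (e e' : Edge n) → f e ≡ f e' → SameEdge e e'

BandwidthAtMost : ∀ {n} → (Edge n → ℤ) → ℕ → Set
BandwidthAtMost {n} f c =
  ∀ (e e' : Edge n) → Incident e e' → ∣ f e - f e' ∣ ≤ c

-- B'(K_n) = b : some edge-numbering achieves B'(f) ≤ b, and every
-- edge-numbering f has B'(f) ≥ b (i.e. every upper bound c of the
-- differences of f satisfies b ≤ c; the max over an empty set is 0).
EdgeBandwidthKn : ℕ → ℕ → Set
EdgeBandwidthKn n b =
  (Σ (Edge n → ℤ) λ f → IsEdgeNumbering f × BandwidthAtMost f b)
  × (∀ (f : Edge n → ℤ) → IsEdgeNumbering f →
       ∀ (c : ℕ) → BandwidthAtMost f c → b ≤ c)

-- ⌊n²/4⌋ + ⌈n/2⌉ - 2 (the value is ≥ 0 for n ≥ 2, so truncated ∸ is exact).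
formula : ℕ → ℕ
formula n = (n * n) / 4 + (n + 1) / 2 ∸ 2

module Submission where

-- Write n = k + r with k = ⌊n/2⌋ and r = ⌈n/2⌉, so that ⌊n²/4⌋ + ⌈n/2⌉ - 2 = (k + 1) r - 2.
--
-- Shift a numbering of bandwidth c to natural labels and choose the threshold t
-- at which the set U of vertices met by edges labelled ≤ t first reaches r vertices. Edges
-- labelled < t lie inside a set of fewer than r vertices; an edge labelled > t + c meets no
-- vertex of U, because it would be incident to an edge labelled ≤ t; and at most c + 1 edges
-- have labels in [t, t + c]. Hence C₂ n ≤ C₂ (r - 1) + C₂ k + c + 1, i.e. (k + 1) r ≤ c + 2.
--
-- Number first the edges inside the first k vertices in colex order, then the
-- k r edges across in two staircases, then the edges inside the last r vertices in reverse
-- colex order. Every vertex then only sees labels from a window of (k + 1) r - 1 consecutive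
-- values, starting at C₂ v for a vertex v < k and mirrored from the top for the others.

open import Data.Nat
open import Data.Nat.Properties
open import Data.Nat.DivMod using (m*n/n≡m; m<n⇒m/n≡0; +-distrib-/-∣ˡ)
open import Data.Nat.Divisibility using (divides-refl)
open import Data.Nat.Tactic.RingSolver using (solve-∀)
open import Data.Integer as ℤ using (ℤ)
import Data.Integer.Properties as ℤ
open import Data.Integer.Tactic.RingSolver using () renaming (solve-∀ to ℤ-solve-∀)
open import Data.Fin using (Fin; zero; suc; toℕ; fromℕ<)
import Data.Fin.Properties as Fin
open import Data.Fin.Properties using (toℕ-fromℕ<; toℕ-injective; toℕ<n; injective⇒≤)
open import Data.List using (List; []; _∷_; _++_; map; length; filter; lookup; allFin; tabulate)
open import Data.List.Properties
  using (length-++; length-map; length-tabulate; map-tabulate; filter-++; filter-all; filter-none; filter-≐)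
open import Data.List.Relation.Unary.All as All using (All; []; _∷_)
import Data.List.Relation.Unary.All.Properties as All
open import Data.List.Relation.Unary.Any using (Any; any?)
open import Data.List.Relation.Unary.Unique.Propositional using (Unique; []; _∷_)
import Data.List.Relation.Unary.Unique.Propositional.Properties as Unique
open import Data.List.Membership.Propositional using (_∈_; lose; find)
open import Data.List.Membership.Propositional.Properties
  using (∈-lookup; ∈-map⁺; ∈-map⁻; ∈-++⁺ˡ; ∈-++⁺ʳ; ∈-allFin)
open import Data.Product using (Σ; ∃; ∃₂; _×_; _,_; proj₁; proj₂)
open import Data.Sum using (inj₁; inj₂)
open import Function using (_∘_; id)
open import Level using (0ℓ)
open import Relation.Binary.PropositionalEquality
open import Relation.Binary.Definitions using (tri<; tri≈; tri>)
open import Relation.Nullary using (¬_; yes; no; contradiction; _×-dec_; _⊎-dec_)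
open import Relation.Unary using (Pred; Decidable; _⊆_; _≐_; _∪_; ∁)
open import Relation.Unary.Properties using (_∪?_; ∁?)
open import Defs

C₂ : ℕ → ℕ
C₂ zero    = zero
C₂ (suc n) = n + C₂ n

C₂-mono-≤ : ∀ {m n} → m ≤ n → C₂ m ≤ C₂ n
C₂-mono-≤ z≤n       = z≤n
C₂-mono-≤ (s≤s m≤n) = +-mono-≤ m≤n (C₂-mono-≤ m≤n)

C₂-+ : ∀ m n → C₂ (m + n) ≡ C₂ m + C₂ n + m * n
C₂-+ zero    n = sym (+-identityʳ (C₂ n))
C₂-+ (suc m) n = begin
  m + n + C₂ (m + n)            ≡⟨ cong (m + n +_) (C₂-+ m n) ⟩
  m + n + (C₂ m + C₂ n + m * n) ≡⟨ regroup m n (C₂ m) (C₂ n) ⟩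
  m + C₂ m + C₂ n + (n + m * n) ∎
  where
  open ≡-Reasoning
  regroup : ∀ m n x y → m + n + (x + y + m * n) ≡ m + x + y + (n + m * n)
  regroup = solve-∀

C₂[1+n]+C₂[n]≡n*n : ∀ n → C₂ (suc n) + C₂ n ≡ n * n
C₂[1+n]+C₂[n]≡n*n zero    = refl
C₂[1+n]+C₂[n]≡n*n (suc n) = begin
  suc n + (n + C₂ n) + (n + C₂ n) ≡⟨ regroup n (C₂ n) ⟩
  suc n + n + (n + C₂ n + C₂ n)   ≡⟨ cong (suc n + n +_) (C₂[1+n]+C₂[n]≡n*n n) ⟩
  suc n + n + n * n               ≡⟨ square n ⟩
  suc n * suc n                   ∎
  where
  open ≡-Reasoning
  regroup : ∀ n x → suc n + (n + x) + (n + x) ≡ suc n + n + (n + x + x)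
  regroup = solve-∀
  square : ∀ n → suc n + n + n * n ≡ suc n * suc n
  square = solve-∀

-- The k × r grid of edges between two halves of sizes k and r ∈ {k, k + 1}
-- splits into two staircases of C₂ (k + 1) and C₂ r cells.
*-as-C₂ : ∀ k {ε} → ε ≤ 1 → k * (k + ε) ≡ C₂ (suc k) + C₂ (k + ε)
*-as-C₂ k z≤n rewrite +-identityʳ k = sym (C₂[1+n]+C₂[n]≡n*n k)
*-as-C₂ k (s≤s z≤n) rewrite +-comm k 1 = begin
  k * suc k                     ≡⟨ *-suc k k ⟩
  k + k * k                     ≡⟨ cong (k +_) (sym (C₂[1+n]+C₂[n]≡n*n k)) ⟩
  k + (C₂ (suc k) + C₂ k)       ≡⟨ cong (k +_) (+-comm (C₂ (suc k)) (C₂ k)) ⟩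
  k + (C₂ k + C₂ (suc k))       ≡⟨ sym (+-assoc k (C₂ k) (C₂ (suc k))) ⟩
  C₂ (suc k) + C₂ (suc k)       ∎
  where open ≡-Reasoning

colex : ℕ → ℕ → ℕ
colex x y = C₂ y + x

colex<C₂ : ∀ {x y Y} → x < y → y < Y → colex x y < C₂ Y
colex<C₂ {x} {y} {Y} x<y y<Y = begin-strict
  C₂ y + x   <⟨ +-monoʳ-< (C₂ y) x<y ⟩
  C₂ y + y   ≡⟨ +-comm (C₂ y) y ⟩
  C₂ (suc y) ≤⟨ C₂-mono-≤ y<Y ⟩
  C₂ Y       ∎
  where open ≤-Reasoning

colex-injective : ∀ {x y x′ y′} → x < y → x′ < y′ → colex x y ≡ colex x′ y′ → x ≡ x′ × y ≡ y′
colex-injective {x} {y} {x′} {y′} x<y x′<y′ eq with <-cmp y y′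
... | tri< y<y′ _ _ = contradiction eq (<⇒≢ (<-≤-trans (colex<C₂ x<y y<y′) (m≤m+n (C₂ y′) x′)))
... | tri> _ _ y′<y = contradiction (sym eq) (<⇒≢ (<-≤-trans (colex<C₂ x′<y′ y′<y) (m≤m+n (C₂ y) x)))
... | tri≈ _ refl _ = +-cancelˡ-≡ (C₂ y) x x′ eq , refl

halves : ∀ n → ∃₂ λ k ε → ε ≤ 1 × n ≡ k + (k + ε)
halves zero          = 0 , 0 , z≤n , refl
halves (suc zero)    = 0 , 1 , ≤-refl , refl
halves (suc (suc n)) with halves n
... | k , ε , ε≤1 , refl = suc k , ε , ε≤1 , cong suc (sym (+-suc k (k + ε)))

[m*n+o]/n≡m : ∀ m {n o} .{{_ : NonZero n}} → o < n → (m * n + o) / n ≡ m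
[m*n+o]/n≡m m {n} {o} o<n = begin
  (m * n + o) / n   ≡⟨ +-distrib-/-∣ˡ o (divides-refl m) ⟩
  m * n / n + o / n ≡⟨ cong₂ _+_ (m*n/n≡m m n) (m<n⇒m/n≡0 o<n) ⟩
  m + 0             ≡⟨ +-identityʳ m ⟩
  m                 ∎
  where open ≡-Reasoning

formula-halves : ∀ k {ε} → ε ≤ 1 → formula (k + (k + ε)) ≡ suc k * (k + ε) ∸ 2
formula-halves k z≤n = cong (_∸ 2) (begin
  n * n / 4 + (n + 1) / 2
    ≡⟨ cong₂ _+_ (cong (_/ 4) (sq k)) (cong (_/ 2) (succ k)) ⟩
  (k * k * 4 + 0) / 4 + (k * 2 + 1) / 2
    ≡⟨ cong₂ _+_ ([m*n+o]/n≡m (k * k) (s≤s z≤n)) ([m*n+o]/n≡m k (s≤s (s≤s z≤n))) ⟩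
  k * k + k
    ≡⟨ close k ⟩
  suc k * (k + 0) ∎)
  where
  open ≡-Reasoning
  n = k + (k + 0)
  sq : ∀ k → (k + (k + 0)) * (k + (k + 0)) ≡ k * k * 4 + 0
  sq = solve-∀
  succ : ∀ k → k + (k + 0) + 1 ≡ k * 2 + 1
  succ = solve-∀
  close : ∀ k → k * k + k ≡ suc k * (k + 0)
  close = solve-∀
formula-halves k (s≤s z≤n) = cong (_∸ 2) (begin
  n * n / 4 + (n + 1) / 2
    ≡⟨ cong₂ _+_ (cong (_/ 4) (sq k)) (cong (_/ 2) (succ k)) ⟩
  ((k * k + k) * 4 + 1) / 4 + (suc k * 2 + 0) / 2
    ≡⟨ cong₂ _+_ ([m*n+o]/n≡m (k * k + k) (s≤s (s≤s z≤n))) ([m*n+o]/n≡m (suc k) {2} (s≤s z≤n)) ⟩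
  k * k + k + suc k
    ≡⟨ close k ⟩
  suc k * (k + 1) ∎)
  where
  open ≡-Reasoning
  n = k + (k + 1)
  sq : ∀ k → (k + (k + 1)) * (k + (k + 1)) ≡ (k * k + k) * 4 + 1
  sq = solve-∀
  succ : ∀ k → k + (k + 1) + 1 ≡ suc k * 2 + 0
  succ = solve-∀
  close : ∀ k → k * k + k + suc k ≡ suc k * (k + 1)
  close = solve-∀

C₂-bound⇒*-bound : ∀ k r c → C₂ (k + suc r) ≤ C₂ k + (C₂ r + suc c) → suc k * suc r ≤ 2 + c
C₂-bound⇒*-bound k r c bound = s≤s (+-cancelˡ-≤ (C₂ k + C₂ r) _ _ (begin
  C₂ k + C₂ r + (r + k * suc r) ≡⟨ regroup (C₂ k) (C₂ r) r (k * suc r) ⟩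
  C₂ k + (r + C₂ r) + k * suc r ≡⟨ sym (C₂-+ k (suc r)) ⟩
  C₂ (k + suc r)                ≤⟨ bound ⟩
  C₂ k + (C₂ r + suc c)         ≡⟨ sym (+-assoc (C₂ k) (C₂ r) (suc c)) ⟩
  C₂ k + C₂ r + suc c           ∎))
  where
  open ≤-Reasoning
  regroup : ∀ x y r p → x + y + (r + p) ≡ x + (r + y) + p
  regroup = solve-∀

∣+m-+n∣≡∣m-n∣ : ∀ m n → ℤ.∣ ℤ.+ m ℤ.- ℤ.+ n ∣ ≡ ∣ m - n ∣
∣+m-+n∣≡∣m-n∣ m n with ≤-total m n
... | inj₁ m≤n = trans (cong ℤ.∣_∣ (ℤ.[+m]-[+n]≡m⊖n m n))
                  (trans (ℤ.∣⊖∣-≤ m≤n) (sym (m≤n⇒∣m-n∣≡n∸m m≤n)))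
... | inj₂ n≤m = trans (cong ℤ.∣_∣ (ℤ.[+m]-[+n]≡m⊖n m n))
                  (trans (ℤ.∣m⊖n∣≡∣n⊖m∣ m n) (trans (ℤ.∣⊖∣-≤ n≤m) (sym (m≤n⇒∣n-m∣≡n∸m n≤m))))

∣m-n∣≤o : ∀ {m n o} → m ≤ n + o → n ≤ m + o → ∣ m - n ∣ ≤ o
∣m-n∣≤o {m} {n} m≤n+o n≤m+o with ≤-total m n
... | inj₁ m≤n = subst (_≤ _) (sym (m≤n⇒∣m-n∣≡n∸m m≤n)) (m≤n+o⇒m∸n≤o n m n≤m+o)
... | inj₂ n≤m = subst (_≤ _) (sym (m≤n⇒∣n-m∣≡n∸m n≤m)) (m≤n+o⇒m∸n≤o m n m≤n+o)

count : ∀ {A : Set} {p} {P : Pred A p} → Decidable P → List A → ℕ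
count P? xs = length (filter P? xs)

module _ {A : Set} where

  module _ {p} {P : Pred A p} (P? : Decidable P) where

    count-++ : ∀ xs ys → count P? (xs ++ ys) ≡ count P? xs + count P? ys
    count-++ xs ys = trans (cong length (filter-++ P? xs ys)) (length-++ (filter P? xs))

    count-all : ∀ {xs} → All P xs → count P? xs ≡ length xs
    count-all all = cong length (filter-all P? all)

    count-complement : ∀ xs → count P? xs + count (∁? P?) xs ≡ length xs
    count-complement []       = refl
    count-complement (x ∷ xs) with P? x
    ... | yes _ = cong suc (count-complement xs)
    ... | no  _ = trans (+-suc _ _) (cong suc (count-complement xs))

    count-none : ∀ {xs} → All (∁ P) xs → count P? xs ≡ 0
    count-none none = cong length (filter-none P? none)

    count-map : ∀ {B : Set} (f : B → A) xs → count P? (map f xs) ≡ count (P? ∘ f) xs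
    count-map f []       = refl
    count-map f (x ∷ xs) with P? (f x)
    ... | yes _ = cong suc (count-map f xs)
    ... | no  _ = count-map f xs

    module _ {q} {Q : Pred A q} (Q? : Decidable Q) where

      count-≐ : P ≐ Q → ∀ xs → count P? xs ≡ count Q? xs
      count-≐ P≐Q xs = cong length (filter-≐ P? Q? P≐Q xs)

      count-mono : P ⊆ Q → ∀ xs → count P? xs ≤ count Q? xs
      count-mono P⊆Q []       = z≤n
      count-mono P⊆Q (x ∷ xs) with P? x | Q? x
      ... | yes _  | yes _  = s≤s (count-mono P⊆Q xs)
      ... | yes px | no ¬qx = contradiction (P⊆Q px) ¬qx
      ... | no _   | yes _  = m≤n⇒m≤1+n (count-mono P⊆Q xs)
      ... | no _   | no _   = count-mono P⊆Q xs

      count-∪ : ∀ xs → count (P? ∪? Q?) xs ≤ count P? xs + count Q? xs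
      count-∪ []       = z≤n
      count-∪ (x ∷ xs) with P? x | Q? x
      ... | yes _ | yes _ = s≤s (≤-trans (count-∪ xs) (+-monoʳ-≤ (count P? xs) (n≤1+n _)))
      ... | yes _ | no _  = s≤s (count-∪ xs)
      ... | no _  | yes _ = ≤-trans (s≤s (count-∪ xs)) (≤-reflexive (sym (+-suc _ _)))
      ... | no _  | no _  = count-∪ xs

  Unique-lookup-injective : ∀ {xs : List A} → Unique xs → ∀ {i j} → lookup xs i ≡ lookup xs j → i ≡ j
  Unique-lookup-injective (_   ∷ _) {zero}  {zero}  _  = refl
  Unique-lookup-injective (x∉ ∷ _) {zero}  {suc j} eq = contradiction eq (All.lookup x∉ (∈-lookup j))
  Unique-lookup-injective (x∉ ∷ _) {suc i} {zero}  eq = contradiction (sym eq) (All.lookup x∉ (∈-lookup i))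
  Unique-lookup-injective (_   ∷ u) {suc i} {suc j} eq = cong suc (Unique-lookup-injective u eq)

Unique-interval⇒length≤ : ∀ {xs} t c → Unique xs → All (λ x → t ≤ x × x ≤ t + c) xs → length xs ≤ suc c
Unique-interval⇒length≤ {xs} t c xs! inside = injective⇒≤ offset-injective
  where
  bounds : ∀ i → t ≤ lookup xs i × lookup xs i ≤ t + c
  bounds i = All.lookup inside (∈-lookup i)

  offset : Fin (length xs) → Fin (suc c)
  offset i = fromℕ< (s≤s (m≤n+o⇒m∸n≤o (lookup xs i) t (proj₂ (bounds i))))

  offset-injective : ∀ {i j} → offset i ≡ offset j → i ≡ j
  offset-injective {i} {j} eq = Unique-lookup-injective xs! (∸-cancelʳ-≡ (proj₁ (bounds i)) (proj₁ (bounds j))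
    (trans (sym (toℕ-fromℕ< _)) (trans (cong toℕ eq) (toℕ-fromℕ< _))))

fromZero : ∀ {n} → Fin n → Edge (suc n)
fromZero j = zero , suc j , s≤s z≤n

liftEdge : ∀ {n} → Edge n → Edge (suc n)
liftEdge e = suc (src e) , suc (tgt e) , s≤s (proj₂ (proj₂ e))

edges : ∀ n → List (Edge n)
edges zero    = []
edges (suc n) = map fromZero (allFin n) ++ map liftEdge (edges n)

SameEdge⇒≡ : ∀ {n} {e e′ : Edge n} → SameEdge e e′ → e ≡ e′
SameEdge⇒≡ {e = i , j , p} {e′ = .i , .j , q} (refl , refl) = cong (λ p → i , j , p) (<-irrelevant p q)

∈-edges : ∀ {n} (e : Edge n) → e ∈ edges n
∈-edges {suc n} (zero  , suc j , s≤s z≤n) = ∈-++⁺ˡ (∈-map⁺ fromZero (∈-allFin j))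
∈-edges {suc n} (suc i , suc j , s≤s i<j) = ∈-++⁺ʳ _ (∈-map⁺ liftEdge (∈-edges (i , j , i<j)))

edges-unique : ∀ n → Unique (edges n)
edges-unique zero    = []
edges-unique (suc n) =
  Unique.++⁺ (Unique.map⁺ fromZero-injective (Unique.allFin⁺ n))
             (Unique.map⁺ liftEdge-injective (edges-unique n))
             disjoint
  where
  fromZero-injective : ∀ {j j′} → fromZero {n} j ≡ fromZero j′ → j ≡ j′
  fromZero-injective refl = refl
  liftEdge-injective : ∀ {e e′} → liftEdge {n} e ≡ liftEdge e′ → e ≡ e′
  liftEdge-injective eq = SameEdge⇒≡ (Fin.suc-injective (cong src eq) , Fin.suc-injective (cong tgt eq))
  disjoint : ∀ {e} → ¬ (e ∈ map fromZero (allFin n) × e ∈ map liftEdge (edges n))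
  disjoint (e∈₁ , e∈₂) with ∈-map⁻ fromZero e∈₁ | ∈-map⁻ liftEdge e∈₂
  ... | _ , _ , refl | _ , _ , ()

length-edges : ∀ n → length (edges n) ≡ C₂ n
length-edges zero    = refl
length-edges (suc n) = begin
  length (map fromZero (allFin n) ++ map liftEdge (edges n))
    ≡⟨ length-++ (map fromZero (allFin n)) ⟩
  length (map fromZero (allFin n)) + length (map liftEdge (edges n))
    ≡⟨ cong₂ _+_ (trans (length-map fromZero (allFin n)) (length-tabulate id))
                 (trans (length-map liftEdge (edges n)) (length-edges n)) ⟩
  n + C₂ n ∎
  where open ≡-Reasoning

hasEnd? : ∀ {n} (e : Edge n) → Decidable (HasEnd e)
hasEnd? e v = (src e Fin.≟ v) ⊎-dec (tgt e Fin.≟ v)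

edgeAt : ∀ {n} → 2 ≤ n → (v : Fin n) → ∃ λ e → HasEnd e v
edgeAt {suc (suc n)} _ zero    = (zero , suc zero , s≤s z≤n) , inj₁ refl
edgeAt {suc (suc n)} _ (suc v) = (zero , suc v , s≤s z≤n) , inj₂ refl
edgeAt {suc zero}    (s≤s ()) zero

inside : ∀ {n} → Pred (Fin n) 0ℓ → Pred (Edge n) 0ℓ
inside W e = W (src e) × W (tgt e)

inside? : ∀ {n} {W : Pred (Fin n) 0ℓ} → Decidable W → Decidable (inside W)
inside? W? e = W? (src e) ×-dec W? (tgt e)

count-inside : ∀ {n} {W : Pred (Fin n) 0ℓ} (W? : Decidable W) →
               count (inside? W?) (edges n) ≡ C₂ (count W? (allFin n))
count-inside {zero}  W? = refl
count-inside {suc n} W? = begin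
  count (inside? W?) (map fromZero (allFin n) ++ map liftEdge (edges n))
    ≡⟨ count-++ (inside? W?) (map fromZero (allFin n)) _ ⟩
  count (inside? W?) (map fromZero (allFin n)) + count (inside? W?) (map liftEdge (edges n))
    ≡⟨ cong₂ _+_ (count-map (inside? W?) fromZero (allFin n)) (count-map (inside? W?) liftEdge (edges n)) ⟩
  count (inside? W? ∘ fromZero) (allFin n) + count (inside? (W? ∘ suc)) (edges n)
    ≡⟨ cong (count (inside? W? ∘ fromZero) (allFin n) +_) (count-inside (W? ∘ suc)) ⟩
  count (inside? W? ∘ fromZero) (allFin n) + C₂ (count (W? ∘ suc) (allFin n))
    ≡⟨ add-zero ⟩
  C₂ (count W? (allFin (suc n))) ∎
  where
  open ≡-Reasoning
  count-nonzero : count W? (tabulate suc) ≡ count (W? ∘ suc) (allFin n)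
  count-nonzero = trans (cong (count W?) (sym (map-tabulate id suc))) (count-map W? suc (allFin n))
  add-zero : count (inside? W? ∘ fromZero) (allFin n) + C₂ (count (W? ∘ suc) (allFin n))
           ≡ C₂ (count W? (allFin (suc n)))
  -- Abstracting W? zero also rewrites the predicate inside? W? ∘ fromZero, hence the λs below.
  add-zero with W? zero
  ... | yes w₀ = cong₂ _+_
    (trans (count-≐ (λ j → yes w₀ ×-dec W? (suc j)) (W? ∘ suc) (proj₂ , (w₀ ,_)) (allFin n)) (sym count-nonzero))
    (cong C₂ (sym count-nonzero))
  ... | no ¬w₀ = cong₂ _+_
    (count-none (λ j → no ¬w₀ ×-dec W? (suc j)) (All.tabulate⁺ {f = id} (λ _ → ¬w₀ ∘ proj₁)))
    (cong C₂ (sym count-nonzero))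

-- Lower bound

switch-on : ∀ {P : Pred ℕ 0ℓ} → Decidable P → ¬ P 0 → ∀ N → P N → ∃ λ t → ¬ P t × P (suc t)
switch-on P? ¬P0 zero    PN  = contradiction PN ¬P0
switch-on P? ¬P0 (suc N) P1+N with P? N
... | yes PN = switch-on P? ¬P0 N PN
... | no ¬PN = N , ¬PN , P1+N

bounded-above : ∀ {A : Set} (h : A → ℕ) xs → ∃ λ N → All (λ x → h x < N) xs
bounded-above h []       = 0 , []
bounded-above h (x ∷ xs) with bounded-above h xs
... | N , below = suc (h x) ⊔ N , m≤m⊔n (suc (h x)) N ∷ All.map (m≤n⇒m≤o⊔n (suc (h x))) below

bounded-below : ∀ {A : Set} (h : A → ℤ) xs → ∃ λ T → All (λ x → T ℤ.≤ h x) xs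
bounded-below h []       = ℤ.0ℤ , []
bounded-below h (x ∷ xs) with bounded-below h xs
... | T , above = h x ℤ.⊓ T , ℤ.i⊓j≤i (h x) T ∷ All.map (ℤ.≤-trans (ℤ.i⊓j≤j (h x) T)) above

shift-to-ℕ : ∀ {n} (f : Edge n → ℤ) → IsEdgeNumbering f → ∀ c → BandwidthAtMost f c →
             Σ (Edge n → ℕ) λ g → (∀ {e e′} → g e ≡ g e′ → e ≡ e′) × (∀ e e′ → Incident e e′ → g e ≤ g e′ + c)
shift-to-ℕ {n} f f-numbering c f-bandwidth = g , g-injective , g-close
  where
  T : ℤ
  T = proj₁ (bounded-below f (edges n))

  g : Edge n → ℕ
  g e = ℤ.∣ f e ℤ.- T ∣

  +g : ∀ e → ℤ.+ g e ≡ f e ℤ.- T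
  +g e = ℤ.0≤i⇒+∣i∣≡i (ℤ.i≤j⇒0≤j-i (All.lookup (proj₂ (bounded-below f (edges n))) (∈-edges e)))

  unshift : ∀ i t → i ≡ (i ℤ.- t) ℤ.+ t
  unshift = ℤ-solve-∀

  difference : ∀ i j t → i ℤ.- j ≡ (i ℤ.- t) ℤ.- (j ℤ.- t)
  difference = ℤ-solve-∀

  g-injective : ∀ {e e′} → g e ≡ g e′ → e ≡ e′
  g-injective {e} {e′} eq = SameEdge⇒≡ (f-numbering e e′ (begin
    f e                 ≡⟨ unshift (f e) T ⟩
    (f e ℤ.- T) ℤ.+ T   ≡⟨ cong (ℤ._+ T) (trans (sym (+g e)) (trans (cong ℤ.+_ eq) (+g e′))) ⟩
    (f e′ ℤ.- T) ℤ.+ T  ≡⟨ sym (unshift (f e′) T) ⟩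
    f e′                ∎))
    where open ≡-Reasoning

  g-close : ∀ e e′ → Incident e e′ → g e ≤ g e′ + c
  g-close e e′ inc = begin
    g e                                         ≤⟨ m≤n+∣m-n∣ (g e) (g e′) ⟩
    g e′ + ∣ g e - g e′ ∣                       ≡⟨ cong (g e′ +_) (sym (∣+m-+n∣≡∣m-n∣ (g e) (g e′))) ⟩
    g e′ + ℤ.∣ ℤ.+ g e ℤ.- ℤ.+ g e′ ∣           ≡⟨ cong (λ i → g e′ + ℤ.∣ i ∣) (cong₂ ℤ._-_ (+g e) (+g e′)) ⟩
    g e′ + ℤ.∣ (f e ℤ.- T) ℤ.- (f e′ ℤ.- T) ∣   ≡⟨ cong (λ i → g e′ + ℤ.∣ i ∣) (sym (difference (f e) (f e′) T)) ⟩
    g e′ + ℤ.∣ f e ℤ.- f e′ ∣                   ≤⟨ +-monoʳ-≤ (g e′) (f-bandwidth e e′ inc) ⟩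
    g e′ + c                                    ∎
    where open ≤-Reasoning

module Threshold {n} (2≤n : 2 ≤ n) (g : Edge n → ℕ) (g-injective : ∀ {e e′} → g e ≡ g e′ → e ≡ e′)
                 (c : ℕ) (g-close : ∀ e e′ → Incident e e′ → g e ≤ g e′ + c) where

  Touched : ℕ → Pred (Fin n) 0ℓ
  Touched t v = Any (λ e → HasEnd e v × g e < t) (edges n)

  touched? : ∀ t → Decidable (Touched t)
  touched? t v = any? (λ e → hasEnd? e v ×-dec g e <? t) (edges n)

  #touched : ℕ → ℕ
  #touched t = count (touched? t) (allFin n)

  crossing : ∀ r → 1 ≤ r → r ≤ n → ∃ λ t → #touched t < r × r ≤ #touched (suc t)
  crossing r 1≤r r≤n with switch-on (λ t → r ≤? #touched t) few-at-0 N many-at-N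
    where
    few-at-0 : ¬ r ≤ #touched 0
    few-at-0 r≤ = n≮0 (≤-trans 1≤r (≤-trans r≤ (≤-reflexive (count-none (touched? 0)
      (All.universal (λ v touched → n≮0 (proj₂ (proj₂ (proj₂ (find touched))))) (allFin n))))))
    N : ℕ
    N = proj₁ (bounded-above g (edges n))
    many-at-N : r ≤ #touched N
    many-at-N = ≤-trans r≤n (≤-reflexive (sym (trans (count-all (touched? N) (All.universal touched (allFin n)))
                                                  (length-tabulate id))))
      where
      touched : ∀ v → Touched N v
      touched v = let (e , e∋v) = edgeAt 2≤n v in
        lose (∈-edges e) (e∋v , All.lookup (proj₂ (bounded-above g (edges n))) (∈-edges e))
  ... | t , ¬r≤ , r≤ = t , ≰⇒> ¬r≤ , r≤

  module _ (t : ℕ) where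

    Below Within Above : Pred (Edge n) 0ℓ
    Below  e = g e < t
    Within e = t ≤ g e × g e ≤ t + c
    Above  e = t + c < g e

    below? : Decidable Below
    below? e = g e <? t

    within? : Decidable Within
    within? e = t ≤? g e ×-dec g e ≤? t + c

    above? : Decidable Above
    above? e = t + c <? g e

    every-band : ∀ e → (Above ∪ (Below ∪ Within)) e
    every-band e with g e <? t | g e ≤? t + c
    ... | yes ge<t | _        = inj₂ (inj₁ ge<t)
    ... | no ge≮t  | yes ge≤  = inj₂ (inj₂ (≮⇒≥ ge≮t , ge≤))
    ... | no _     | no ge≰   = inj₁ (≰⇒> ge≰)

    below-inside : Below ⊆ inside (Touched t)
    below-inside {e} ge<t = lose (∈-edges e) (inj₁ refl , ge<t) , lose (∈-edges e) (inj₂ refl , ge<t)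

    -- An edge labelled above t + c cannot meet an edge labelled at most t.
    above-outside : Above ⊆ inside (∁ (Touched (suc t)))
    above-outside {e} t+c<ge = untouched (inj₁ refl) , untouched (inj₂ refl)
      where
      untouched : ∀ {v} → HasEnd e v → ¬ Touched (suc t) v
      untouched e∋v touched with find touched
      ... | e′ , _ , e′∋v , ge′≤t =
        <⇒≱ t+c<ge (≤-trans (g-close e e′ (e≢e′ , _ , e∋v , e′∋v)) (+-monoˡ-≤ c (s≤s⁻¹ ge′≤t)))
        where
        e≢e′ : ¬ SameEdge e e′
        e≢e′ same =
          <⇒≱ t+c<ge (≤-trans (≤-reflexive (cong g (SameEdge⇒≡ same))) (≤-trans (s≤s⁻¹ ge′≤t) (m≤m+n t c)))

    #below≤ : ∀ {m} → #touched t ≤ m → count below? (edges n) ≤ C₂ m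
    #below≤ {m} few = begin
      count below? (edges n)                  ≤⟨ count-mono below? (inside? (touched? t)) below-inside (edges n) ⟩
      count (inside? (touched? t)) (edges n)  ≡⟨ count-inside (touched? t) ⟩
      C₂ (#touched t)                         ≤⟨ C₂-mono-≤ few ⟩
      C₂ m                                    ∎
      where open ≤-Reasoning

    #above≤ : ∀ {k m} → n ≡ k + m → m ≤ #touched (suc t) → count above? (edges n) ≤ C₂ k
    #above≤ {k} {m} n≡k+m many = begin
      count above? (edges n)                  ≤⟨ count-mono above? (inside? untouched?) above-outside (edges n) ⟩
      count (inside? untouched?) (edges n)    ≡⟨ count-inside untouched? ⟩
      C₂ (count untouched? (allFin n))        ≤⟨ C₂-mono-≤ #untouched≤ ⟩
      C₂ k                                    ∎
      where
      open ≤-Reasoning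
      untouched? : Decidable (∁ (Touched (suc t)))
      untouched? = ∁? (touched? (suc t))
      #untouched≤ : count untouched? (allFin n) ≤ k
      #untouched≤ = +-cancelʳ-≤ m _ k (begin
        count untouched? (allFin n) + m                 ≤⟨ +-monoʳ-≤ _ many ⟩
        count untouched? (allFin n) + #touched (suc t)  ≡⟨ +-comm _ (#touched (suc t)) ⟩
        #touched (suc t) + count untouched? (allFin n)  ≡⟨ count-complement (touched? (suc t)) (allFin n) ⟩
        length (allFin n)                               ≡⟨ trans (length-tabulate id) n≡k+m ⟩
        k + m                                           ∎)

    #within≤ : count within? (edges n) ≤ suc c
    #within≤ = subst (_≤ suc c) (length-map g (filter within? (edges n)))
      (Unique-interval⇒length≤ t c (Unique.map⁺ g-injective (Unique.filter⁺ within? (edges-unique n)))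
                                   (All.map⁺ (All.all-filter within? (edges n))))

  numbering-bound : ∀ k r → n ≡ k + suc r → suc k * suc r ≤ 2 + c
  numbering-bound k r refl with crossing (suc r) (s≤s z≤n) (m≤n+m (suc r) k)
  ... | t , few , many = C₂-bound⇒*-bound k r c (begin
    C₂ n
      ≡⟨ sym (length-edges n) ⟩
    length (edges n)
      ≡⟨ sym (count-all (above? t ∪? (below? t ∪? within? t)) (All.universal (every-band t) (edges n))) ⟩
    count (above? t ∪? (below? t ∪? within? t)) (edges n)
      ≤⟨ count-∪ (above? t) (below? t ∪? within? t) (edges n) ⟩
    count (above? t) (edges n) + count (below? t ∪? within? t) (edges n)
      ≤⟨ +-monoʳ-≤ _ (count-∪ (below? t) (within? t) (edges n)) ⟩
    count (above? t) (edges n) + (count (below? t) (edges n) + count (within? t) (edges n))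
      ≤⟨ +-mono-≤ (#above≤ t refl many) (+-mono-≤ (#below≤ t (s≤s⁻¹ few)) (#within≤ t)) ⟩
    C₂ k + (C₂ r + suc c) ∎)
    where open ≤-Reasoning

lower-bound : ∀ k r {n} → n ≡ k + suc r → 2 ≤ n → (f : Edge n → ℤ) → IsEdgeNumbering f →
              ∀ c → BandwidthAtMost f c → suc k * suc r ≤ 2 + c
lower-bound k r n≡ 2≤n f f-numbering c f-bandwidth with shift-to-ℕ f f-numbering c f-bandwidth
... | g , g-injective , g-close = Threshold.numbering-bound 2≤n g g-injective c g-close k r n≡

-- Upper bound

crossEarly-right-fits : ∀ {k ε u s z} → ε ≤ 1 → u < s → s ≤ k → suc z ≡ s + ε →
  colex u s + (C₂ (k + ε) + C₂ (k + ε)) + 2 ≤ C₂ z + ((k + ε) + (C₂ (suc k) + C₂ (k + ε)))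
crossEarly-right-fits {k} {u = u} {s} {z} z≤n u<s s≤k 1+z≡s+0
  rewrite +-identityʳ k | +-identityʳ s | sym 1+z≡s+0 = begin
  C₂ (suc z) + u + (C₂ k + C₂ k) + 2   ≡⟨ regroup₁ z u (C₂ z) (C₂ k) ⟩
  C₂ z + (C₂ k + C₂ k) + (suc z + suc u) ≤⟨ +-monoʳ-≤ _ (+-mono-≤ s≤k (≤-trans u<s s≤k)) ⟩
  C₂ z + (C₂ k + C₂ k) + (k + k)        ≡⟨ regroup₂ k (C₂ z) (C₂ k) ⟩
  C₂ z + (k + (k + C₂ k + C₂ k))        ∎
  where
  open ≤-Reasoning
  regroup₁ : ∀ z u x y → z + x + u + (y + y) + 2 ≡ x + (y + y) + (suc z + suc u)
  regroup₁ = solve-∀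
  regroup₂ : ∀ k x y → x + (y + y) + (k + k) ≡ x + (k + (k + y + y))
  regroup₂ = solve-∀
crossEarly-right-fits {k} {u = u} {s} {z} (s≤s z≤n) u<s s≤k 1+z≡s+1
  rewrite +-comm k 1 | +-comm s 1 | suc-injective 1+z≡s+1 = begin
  C₂ s + u + (C₂ (suc k) + C₂ (suc k)) + 2     ≡⟨ regroup₁ u (C₂ s) (C₂ (suc k)) ⟩
  C₂ s + (C₂ (suc k) + C₂ (suc k)) + suc (suc u) ≤⟨ +-monoʳ-≤ _ (s≤s (≤-trans u<s s≤k)) ⟩
  C₂ s + (C₂ (suc k) + C₂ (suc k)) + suc k     ≡⟨ regroup₂ (suc k) (C₂ s) (C₂ (suc k)) ⟩
  C₂ s + (suc k + (C₂ (suc k) + C₂ (suc k)))   ∎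
  where
  open ≤-Reasoning
  regroup₁ : ∀ u x y → x + u + (y + y) + 2 ≡ x + (y + y) + suc (suc u)
  regroup₁ = solve-∀
  regroup₂ : ∀ k x y → x + (y + y) + k ≡ x + (k + (y + y))
  regroup₂ = solve-∀

crossLate-left-fits : ∀ {k ε a d} → ε ≤ 1 → a < k → d < a + ε →
  C₂ k + C₂ (suc k) + colex d (a + ε) + 2 ≤ C₂ a + ((k + ε) + (C₂ (suc k) + C₂ (k + ε)))
crossLate-left-fits {k} {a = a} {d} z≤n a<k d<a+0 rewrite +-identityʳ k | +-identityʳ a = begin
  C₂ k + C₂ (suc k) + (C₂ a + d) + 2      ≡⟨ regroup₁ d (C₂ a) (C₂ k) (C₂ (suc k)) ⟩
  C₂ a + (C₂ (suc k) + C₂ k) + suc (suc d) ≤⟨ +-monoʳ-≤ _ (≤-trans (s≤s d<a+0) a<k) ⟩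
  C₂ a + (C₂ (suc k) + C₂ k) + k           ≡⟨ regroup₂ k (C₂ a) (C₂ (suc k) + C₂ k) ⟩
  C₂ a + (k + (C₂ (suc k) + C₂ k))         ∎
  where
  open ≤-Reasoning
  regroup₁ : ∀ d x y w → y + w + (x + d) + 2 ≡ x + (w + y) + suc (suc d)
  regroup₁ = solve-∀
  regroup₂ : ∀ k x y → x + y + k ≡ x + (k + y)
  regroup₂ = solve-∀
crossLate-left-fits {k} {a = a} {d} (s≤s z≤n) a<k d<a+1 rewrite +-comm k 1 | +-comm a 1 = begin
  C₂ k + (k + C₂ k) + (a + C₂ a + d) + 2          ≡⟨ regroup₁ k a d (C₂ a) (C₂ k) ⟩
  C₂ a + (C₂ k + (k + C₂ k)) + (suc a + suc d)    ≤⟨ +-monoʳ-≤ _ (+-mono-≤ a<k (≤-trans d<a+1 (m≤n⇒m≤1+n a<k))) ⟩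
  C₂ a + (C₂ k + (k + C₂ k)) + (k + suc k)        ≡⟨ regroup₂ k (C₂ a) (C₂ k) ⟩
  C₂ a + (suc k + (k + C₂ k + (k + C₂ k)))        ∎
  where
  open ≤-Reasoning
  regroup₁ : ∀ k a d x y → y + (k + y) + (a + x + d) + 2 ≡ x + (y + (k + y)) + (suc a + suc d)
  regroup₁ = solve-∀
  regroup₂ : ∀ k x y → x + (y + (k + y)) + (k + suc k) ≡ x + (suc k + (k + y + (k + y)))
  regroup₂ = solve-∀

module Construction (k ε : ℕ) (1≤k : 1 ≤ k) (ε≤1 : ε ≤ 1) where

  r : ℕ
  r = k + ε

  n : ℕ
  n = k + r

  blockSize : ℕ → ℕ
  blockSize 0 = C₂ k
  blockSize 1 = C₂ (suc k)
  blockSize _ = C₂ r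

  blockStart : ℕ → ℕ
  blockStart zero    = 0
  blockStart (suc i) = blockStart i + blockSize i

  blockStart-mono-≤ : ∀ {i j} → i ≤ j → blockStart i ≤ blockStart j
  blockStart-mono-≤ {j = zero}  z≤n   = ≤-refl
  blockStart-mono-≤ {j = suc j} i≤1+j with m≤n⇒m<n∨m≡n i≤1+j
  ... | inj₁ i<1+j = ≤-trans (blockStart-mono-≤ (s≤s⁻¹ i<1+j)) (m≤m+n (blockStart j) (blockSize j))
  ... | inj₂ refl  = ≤-refl

  top : ℕ
  top = blockStart 4

  -- The labels form four consecutive blocks: edges inside the left half (vertices below k),
  -- crossing edges {a, b} with a + b < 2k, the other crossing edges, and edges inside the right
  -- half, whose vertices v are also indexed from the top by z with v + 1 + z = n. Within its
  -- block an edge is placed by the colex rank of the pair (a, b), (u, s), (d, a + ε) or (z₂, z₁);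
  -- blocks 1 and 3 are filled from the end.
  data Region : ℕ → ℕ → ℕ → Set where
    left       : ∀ {a b} → a < b → b < k → Region 0 a b
    crossEarly : ∀ {a b} u s → a + suc u ≡ s → s ≤ k → b + s ≡ k + k → Region 1 a b
    crossLate  : ∀ {a b} d → a < k → d < a + ε → a + b ≡ k + k + d → Region 2 a b
    right      : ∀ {a b} z₁ z₂ → k ≤ a → a + suc z₁ ≡ n → b + suc z₂ ≡ n → z₂ < z₁ → Region 3 a b

  position : ∀ {i a b} → Region i a b → ℕ
  position {a = a} {b} (left _ _)        = colex a b
  position (crossEarly u s _ _ _)        = C₂ (suc k) ∸ suc (colex u s)
  position {a = a} (crossLate d _ _ _)   = colex d (a + ε)
  position (right z₁ z₂ _ _ _ _)         = C₂ r ∸ suc (colex z₂ z₁)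

  label : ∀ {i a b} → Region i a b → ℕ
  label {i} ρ = blockStart i + position ρ

  1≤r : 1 ≤ r
  1≤r = ≤-trans 1≤k (m≤m+n k ε)

  mirror-< : ∀ {v z} → k ≤ v → v + suc z ≡ n → z < r
  mirror-< {v} {z} k≤v v+1+z≡n = +-cancelˡ-≤ k (suc z) r (≤-trans (+-monoˡ-≤ (suc z) k≤v) (≤-reflexive v+1+z≡n))

  mirror-≡ : ∀ {v} → v < n → v + suc (n ∸ suc v) ≡ n
  mirror-≡ {v} v<n = trans (+-suc v (n ∸ suc v)) (m+[n∸m]≡n v<n)

  mirror-unique : ∀ {v z z′} → v + suc z ≡ n → v + suc z′ ≡ n → z ≡ z′
  mirror-unique {v} eq eq′ = suc-injective (+-cancelˡ-≡ v _ _ (trans eq (sym eq′)))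

  mirror-antitone : ∀ {v v′ z z′} → v + suc z ≡ n → v′ + suc z′ ≡ n → z′ < z → v < v′
  mirror-antitone {v} {v′} {z} {z′} eq eq′ z′<z = +-cancelʳ-< (suc z′) v v′ (begin-strict
    v + suc z′  <⟨ +-monoʳ-< v (s≤s z′<z) ⟩
    v + suc z   ≡⟨ trans eq (sym eq′) ⟩
    v′ + suc z′ ∎)
    where open ≤-Reasoning

  crossEarly-u<s : ∀ {a u s} → a + suc u ≡ s → u < s
  crossEarly-u<s {a} {u} eq = ≤-trans (m≤n+m (suc u) a) (≤-reflexive eq)

  crossEarly-a<k : ∀ {a u s} → a + suc u ≡ s → s ≤ k → a < k
  crossEarly-a<k {a} {u} eq s≤k = ≤-trans (≤-trans (s≤s (m≤m+n a u)) (≤-reflexive (trans (sym (+-suc a u)) eq))) s≤k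

  position<blockSize : ∀ {i a b} (ρ : Region i a b) → position ρ < blockSize i
  position<blockSize (left a<b b<k)                 = colex<C₂ a<b b<k
  position<blockSize (crossEarly u s eq s≤k _)      = ∸-monoʳ-< z<s (colex<C₂ (crossEarly-u<s eq) (s≤s s≤k))
  position<blockSize (crossLate d a<k d<a+ε _)      = colex<C₂ d<a+ε (+-monoˡ-< ε a<k)
  position<blockSize (right z₁ z₂ k≤a eq _ z₂<z₁)   = ∸-monoʳ-< z<s (colex<C₂ z₂<z₁ (mirror-< k≤a eq))

  blockStart≤label : ∀ {i a b} (ρ : Region i a b) → blockStart i ≤ label ρ
  blockStart≤label {i} ρ = m≤m+n (blockStart i) (position ρ)

  label<blockStart : ∀ {i j a b} (ρ : Region i a b) → i < j → label ρ < blockStart j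
  label<blockStart {i} ρ i<j = <-≤-trans (+-monoʳ-< (blockStart i) (position<blockSize ρ)) (blockStart-mono-≤ i<j)

  same-block : ∀ {i j a b a′ b′} (ρ : Region i a b) (ρ′ : Region j a′ b′) → label ρ ≡ label ρ′ → i ≡ j
  same-block {i} {j} ρ ρ′ eq with <-cmp i j
  ... | tri< i<j _ _ = contradiction eq (<⇒≢ (<-≤-trans (label<blockStart ρ i<j) (blockStart≤label ρ′)))
  ... | tri≈ _ i≡j _ = i≡j
  ... | tri> _ _ j<i = contradiction (sym eq) (<⇒≢ (<-≤-trans (label<blockStart ρ′ j<i) (blockStart≤label ρ)))

  position-injective : ∀ {i a b a′ b′} (ρ : Region i a b) (ρ′ : Region i a′ b′) →
                       position ρ ≡ position ρ′ → a ≡ a′ × b ≡ b′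
  position-injective (left a<b _) (left a′<b′ _) eq = colex-injective a<b a′<b′ eq
  position-injective (crossEarly u s a+1+u≡s s≤k b+s≡2k) (crossEarly u′ s′ a′+1+u′≡s′ s′≤k b′+s′≡2k) eq
    with colex-injective (crossEarly-u<s a+1+u≡s) (crossEarly-u<s a′+1+u′≡s′)
           (suc-injective (∸-cancelˡ-≡ (colex<C₂ (crossEarly-u<s a+1+u≡s) (s≤s s≤k))
                                       (colex<C₂ (crossEarly-u<s a′+1+u′≡s′) (s≤s s′≤k)) eq))
  ... | refl , refl = +-cancelʳ-≡ (suc u) _ _ (trans a+1+u≡s (sym a′+1+u′≡s′))
                    , +-cancelʳ-≡ s _ _ (trans b+s≡2k (sym b′+s′≡2k))
  position-injective {a = a} {b} {a′} {b′} (crossLate d _ d<a+ε a+b≡) (crossLate d′ _ d′<a′+ε a′+b′≡) eq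
    with colex-injective d<a+ε d′<a′+ε eq
  ... | refl , a+ε≡a′+ε with +-cancelʳ-≡ ε a a′ a+ε≡a′+ε
  ... | refl = refl , +-cancelˡ-≡ a b b′ (trans a+b≡ (sym a′+b′≡))
  position-injective (right z₁ z₂ k≤a a+1+z₁≡n b+1+z₂≡n z₂<z₁) (right z₁′ z₂′ k≤a′ a′+1+z₁′≡n b′+1+z₂′≡n z₂′<z₁′) eq
    with colex-injective z₂<z₁ z₂′<z₁′
           (suc-injective (∸-cancelˡ-≡ (colex<C₂ z₂<z₁ (mirror-< k≤a a+1+z₁≡n))
                                       (colex<C₂ z₂′<z₁′ (mirror-< k≤a′ a′+1+z₁′≡n)) eq))
  ... | refl , refl = +-cancelʳ-≡ (suc z₁) _ _ (trans a+1+z₁≡n (sym a′+1+z₁′≡n))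
                    , +-cancelʳ-≡ (suc z₂) _ _ (trans b+1+z₂≡n (sym b′+1+z₂′≡n))

  label-injective : ∀ {i j a b a′ b′} (ρ : Region i a b) (ρ′ : Region j a′ b′) →
                    label ρ ≡ label ρ′ → a ≡ a′ × b ≡ b′
  label-injective {i} ρ ρ′ eq with same-block ρ ρ′ eq
  ... | refl = position-injective ρ ρ′ (+-cancelˡ-≡ (blockStart i) _ _ eq)

  B : ℕ
  B = suc k * r ∸ 2

  B+2≡′ : B + 2 ≡ suc k * r
  B+2≡′ = m∸n+n≡m (*-mono-≤ (s≤s 1≤k) 1≤r)

  B+2≡ : B + 2 ≡ r + (C₂ (suc k) + C₂ r)
  B+2≡ = trans B+2≡′ (cong (r +_) (*-as-C₂ k ε≤1))

  Near : ℕ → ℕ → Set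
  Near lo ℓ = lo ≤ ℓ × ℓ ≤ lo + B

  near : ∀ {lo ℓ} → lo ≤ ℓ → ℓ + 2 ≤ lo + (B + 2) → Near lo ℓ
  near {lo} {ℓ} lo≤ℓ ℓ+2≤ = lo≤ℓ , +-cancelʳ-≤ 2 ℓ (lo + B) (≤-trans ℓ+2≤ (≤-reflexive (sym (+-assoc lo B 2))))

  near-below : ∀ {lo ℓ M} → lo ≤ ℓ → ℓ < M → M < B + 2 → Near lo ℓ
  near-below {lo} {ℓ} {M} lo≤ℓ ℓ<M M<B+2 = near lo≤ℓ (begin
    ℓ + 2         ≡⟨ +-comm ℓ 2 ⟩
    suc (suc ℓ)   ≤⟨ s≤s ℓ<M ⟩
    suc M         ≤⟨ M<B+2 ⟩
    B + 2         ≤⟨ m≤n+m (B + 2) lo ⟩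
    lo + (B + 2)  ∎)
    where open ≤-Reasoning

  near-colex : ∀ {x y} → x < y → y < B + 2 → Near (C₂ y) (colex x y)
  near-colex {x} {y} x<y y<B+2 = near (m≤m+n (C₂ y) x) (begin
    C₂ y + x + 2        ≡⟨ +-assoc (C₂ y) x 2 ⟩
    C₂ y + (x + 2)      ≡⟨ cong (C₂ y +_) (+-comm x 2) ⟩
    C₂ y + suc (suc x)  ≤⟨ +-monoʳ-≤ (C₂ y) (≤-trans (s≤s x<y) y<B+2) ⟩
    C₂ y + (B + 2)      ∎)
    where open ≤-Reasoning

  first-blocks<B+2 : blockStart 2 < B + 2
  first-blocks<B+2 = begin
    suc (C₂ k + C₂ (suc k))   ≡⟨ cong suc (+-comm (C₂ k) (C₂ (suc k))) ⟩
    1 + (C₂ (suc k) + C₂ k)   ≤⟨ +-mono-≤ 1≤r (+-monoʳ-≤ (C₂ (suc k)) (C₂-mono-≤ (m≤m+n k ε))) ⟩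
    r + (C₂ (suc k) + C₂ r)   ≡⟨ sym B+2≡ ⟩
    B + 2                     ∎
    where open ≤-Reasoning

  last-blocks<B+2 : C₂ r + C₂ r < B + 2
  last-blocks<B+2 = ≤-trans (+-mono-≤ 1≤r (+-monoˡ-≤ (C₂ r) (C₂-mono-≤ r≤1+k))) (≤-reflexive (sym B+2≡))
    where
    r≤1+k : r ≤ suc k
    r≤1+k = ≤-trans (+-monoʳ-≤ k ε≤1) (≤-reflexive (+-comm k 1))

  r<B+2 : r < B + 2
  r<B+2 = ≤-trans (≤-trans (≤-reflexive (+-comm 1 r)) (+-monoʳ-≤ r 1≤k*r)) (≤-reflexive (sym B+2≡′))
    where
    1≤k*r : 1 ≤ k * r
    1≤k*r = *-mono-≤ 1≤k 1≤r

  mirror : ∀ {ℓ q lo} → ℓ + suc q ≡ top → Near lo q → Near (ℓ + suc lo) top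
  mirror {ℓ} {q} {lo} eq (lo≤q , q≤lo+B) = ≤-trans (+-monoʳ-≤ ℓ (s≤s lo≤q)) (≤-reflexive eq) , (begin
    top                  ≡⟨ sym eq ⟩
    ℓ + suc q            ≤⟨ +-monoʳ-≤ ℓ (s≤s q≤lo+B) ⟩
    ℓ + (suc lo + B)     ≡⟨ sym (+-assoc ℓ (suc lo) B) ⟩
    ℓ + suc lo + B       ∎)
    where open ≤-Reasoning

  -- The labels at a vertex v lie in a window of B + 1 consecutive values: starting at C₂ v if
  -- v < k, and ending at top - 1 - C₂ z if v + 1 + z = n.
  Window : ℕ → ℕ → Set
  Window v ℓ = (v < k → Near (C₂ v) ℓ) × (∀ {z} → k ≤ v → v + suc z ≡ n → Near (ℓ + suc (C₂ z)) top)

  window-close : ∀ {v ℓ ℓ′} → v < n → Window v ℓ → Window v ℓ′ → ℓ ≤ ℓ′ + B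
  window-close {v} {ℓ} {ℓ′} v<n (near-left , near-right) (near-left′ , near-right′) with v <? k
  ... | yes v<k = ≤-trans (proj₂ (near-left v<k)) (+-monoˡ-≤ B (proj₁ (near-left′ v<k)))
  ... | no v≮k  = +-cancelʳ-≤ (suc (C₂ z)) ℓ (ℓ′ + B) (begin
    ℓ + suc (C₂ z)      ≤⟨ proj₁ (near-right (≮⇒≥ v≮k) v+1+z≡n) ⟩
    top                 ≤⟨ proj₂ (near-right′ (≮⇒≥ v≮k) v+1+z≡n) ⟩
    ℓ′ + suc (C₂ z) + B ≡⟨ +-assoc ℓ′ (suc (C₂ z)) B ⟩
    ℓ′ + (suc (C₂ z) + B) ≡⟨ cong (ℓ′ +_) (+-comm (suc (C₂ z)) B) ⟩
    ℓ′ + (B + suc (C₂ z)) ≡⟨ sym (+-assoc ℓ′ B (suc (C₂ z))) ⟩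
    ℓ′ + B + suc (C₂ z) ∎)
    where
    open ≤-Reasoning
    z : ℕ
    z = n ∸ suc v
    v+1+z≡n : v + suc z ≡ n
    v+1+z≡n = mirror-≡ v<n

  backward-label : ∀ i {q} → q < blockSize i → blockStart i + (blockSize i ∸ suc q) + suc q ≡ blockStart (suc i)
  backward-label i {q} q< = trans (+-assoc (blockStart i) _ (suc q)) (cong (blockStart i +_) (m∸n+n≡m q<))

  window-src : ∀ {i a b} (ρ : Region i a b) → Window a (label ρ)
  window-src ρ@(left {a} {b} a<b b<k) =
      (λ _ → near-below (≤-trans (C₂-mono-≤ (<⇒≤ a<b)) (m≤m+n (C₂ b) a))
                        (label<blockStart {j = 2} ρ z<s) first-blocks<B+2)
    , (λ k≤a → contradiction k≤a (<⇒≱ (<-trans a<b b<k)))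
  window-src ρ@(crossEarly u s a+1+u≡s s≤k _) =
      (λ _ → near-below (≤-trans (C₂-mono-≤ (<⇒≤ a<k)) (blockStart≤label ρ))
                        (label<blockStart {j = 2} ρ (s<s z<s)) first-blocks<B+2)
    , (λ k≤a → contradiction k≤a (<⇒≱ a<k))
    where a<k = crossEarly-a<k a+1+u≡s s≤k
  window-src ρ@(crossLate {a} d a<k d<a+ε _) =
      (λ _ → near (≤-trans (C₂-mono-≤ (<⇒≤ a<k)) (≤-trans (m≤m+n (C₂ k) (C₂ (suc k))) (blockStart≤label ρ)))
                  (subst (λ w → label ρ + 2 ≤ C₂ a + w) (sym B+2≡) (crossLate-left-fits ε≤1 a<k d<a+ε)))
    , (λ k≤a → contradiction k≤a (<⇒≱ a<k))
  window-src ρ@(right z₁ z₂ k≤a a+1+z₁≡n _ z₂<z₁) =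
      (λ a<k → contradiction k≤a (<⇒≱ a<k))
    , (λ _ a+1+z≡n → subst (λ z → Near (label ρ + suc (C₂ z)) top) (mirror-unique a+1+z₁≡n a+1+z≡n)
        (mirror (backward-label 3 q<C₂r) (near-colex z₂<z₁ (<-trans (mirror-< k≤a a+1+z₁≡n) r<B+2))))
    where q<C₂r = colex<C₂ z₂<z₁ (mirror-< k≤a a+1+z₁≡n)

  crossEarly-k≤b : ∀ {b s} → s ≤ k → b + s ≡ k + k → k ≤ b
  crossEarly-k≤b {b} {s} s≤k b+s≡2k = +-cancelʳ-≤ s k b (≤-trans (+-monoʳ-≤ k s≤k) (≤-reflexive (sym b+s≡2k)))

  crossLate-k≤b : ∀ {a b d} → a < k → a + b ≡ k + k + d → k ≤ b
  crossLate-k≤b {a} {b} {d} a<k a+b≡ = +-cancelˡ-≤ k k b (begin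
    k + k       ≤⟨ m≤m+n (k + k) d ⟩
    k + k + d   ≡⟨ sym a+b≡ ⟩
    a + b       ≤⟨ +-monoˡ-≤ b (<⇒≤ a<k) ⟩
    k + b       ∎)
    where open ≤-Reasoning

  crossEarly-right-window : ∀ {a b} (ρ : Region 1 a b) {z} → b + suc z ≡ n → Near (label ρ + suc (C₂ z)) top
  crossEarly-right-window ρ@(crossEarly {b = b} u s a+1+u≡s s≤k b+s≡2k) {z} b+1+z≡n =
    mirror label+1+q̄≡top
      (near C₂z≤q̄ (subst (λ w → q̄ + 2 ≤ C₂ z + w) (sym B+2≡) (crossEarly-right-fits ε≤1 u<s s≤k 1+z≡s+ε)))
    where
    u<s = crossEarly-u<s a+1+u≡s
    q = colex u s
    q̄ = q + (C₂ r + C₂ r)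
    label+1+q̄≡top : label ρ + suc q̄ ≡ top
    label+1+q̄≡top = trans (sym (+-assoc (label ρ) (suc q) (C₂ r + C₂ r)))
      (trans (cong (_+ (C₂ r + C₂ r)) (backward-label 1 (colex<C₂ u<s (s≤s s≤k))))
             (sym (+-assoc (blockStart 2) (C₂ r) (C₂ r))))
    C₂z≤q̄ : C₂ z ≤ q̄
    C₂z≤q̄ = ≤-trans (C₂-mono-≤ (<⇒≤ (mirror-< (crossEarly-k≤b s≤k b+s≡2k) b+1+z≡n)))
                    (≤-trans (m≤m+n (C₂ r) (C₂ r)) (m≤n+m _ q))
    1+z≡s+ε : suc z ≡ s + ε
    1+z≡s+ε = +-cancelˡ-≡ b (suc z) (s + ε) (begin
      b + suc z     ≡⟨ b+1+z≡n ⟩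
      k + (k + ε)   ≡⟨ sym (+-assoc k k ε) ⟩
      k + k + ε     ≡⟨ cong (_+ ε) (sym b+s≡2k) ⟩
      b + s + ε     ≡⟨ +-assoc b s ε ⟩
      b + (s + ε)   ∎)
      where open ≡-Reasoning

  crossLate-right-window : ∀ {a b} (ρ : Region 2 a b) {z} → b + suc z ≡ n → Near (label ρ + suc (C₂ z)) top
  crossLate-right-window ρ@(crossLate {a} d a<k d<a+ε a+b≡) {z} b+1+z≡n =
    mirror label+1+q̄≡top (near-below C₂z≤q̄ q̄<2C₂r last-blocks<B+2)
    where
    q = colex d (a + ε)
    q<C₂r : q < C₂ r
    q<C₂r = colex<C₂ d<a+ε (+-monoˡ-< ε a<k)
    q̄ = (C₂ r ∸ suc q) + C₂ r
    label+1+q̄≡top : label ρ + suc q̄ ≡ top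
    label+1+q̄≡top = begin
      blockStart 2 + q + suc (C₂ r ∸ suc q + C₂ r)   ≡⟨ regroup (blockStart 2) q (C₂ r ∸ suc q) (C₂ r) ⟩
      blockStart 2 + (q + suc (C₂ r ∸ suc q)) + C₂ r ≡⟨ cong (λ x → blockStart 2 + x + C₂ r) q+1+[C₂r∸1+q]≡C₂r ⟩
      blockStart 2 + C₂ r + C₂ r                     ∎
      where
      open ≡-Reasoning
      regroup : ∀ x q y w → x + q + suc (y + w) ≡ x + (q + suc y) + w
      regroup = solve-∀
      q+1+[C₂r∸1+q]≡C₂r : q + suc (C₂ r ∸ suc q) ≡ C₂ r
      q+1+[C₂r∸1+q]≡C₂r = trans (+-suc q _) (m+[n∸m]≡n q<C₂r)
    C₂z≤q̄ : C₂ z ≤ q̄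
    C₂z≤q̄ = ≤-trans (C₂-mono-≤ (<⇒≤ (mirror-< (crossLate-k≤b a<k a+b≡) b+1+z≡n))) (m≤n+m (C₂ r) _)
    q̄<2C₂r : q̄ < C₂ r + C₂ r
    q̄<2C₂r = +-monoˡ-< (C₂ r) (∸-monoʳ-< z<s q<C₂r)

  window-tgt : ∀ {i a b} (ρ : Region i a b) → Window b (label ρ)
  window-tgt (left a<b b<k) =
      (λ _ → near-colex a<b (<-≤-trans b<k (≤-trans (m≤m+n k ε) (<⇒≤ r<B+2))))
    , (λ k≤b → contradiction k≤b (<⇒≱ b<k))
  window-tgt ρ@(crossEarly _ _ _ s≤k b+s≡2k) =
      (λ b<k → contradiction (crossEarly-k≤b s≤k b+s≡2k) (<⇒≱ b<k))
    , (λ _ → crossEarly-right-window ρ)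
  window-tgt ρ@(crossLate _ a<k _ a+b≡) =
      (λ b<k → contradiction (crossLate-k≤b a<k a+b≡) (<⇒≱ b<k))
    , (λ _ → crossLate-right-window ρ)
  window-tgt ρ@(right z₁ z₂ k≤a a+1+z₁≡n b+1+z₂≡n z₂<z₁) =
      (λ b<k → contradiction k≤a (<⇒≱ (<-trans (mirror-antitone a+1+z₁≡n b+1+z₂≡n z₂<z₁) b<k)))
    , (λ _ b+1+z≡n → subst (λ z → Near (label ρ + suc (C₂ z)) top) (mirror-unique b+1+z₂≡n b+1+z≡n)
        (mirror (backward-label 3 q<C₂r)
                (near-below (≤-trans (C₂-mono-≤ (<⇒≤ z₂<z₁)) (m≤m+n (C₂ z₁) z₂))
                            (≤-trans q<C₂r (m≤m+n (C₂ r) (C₂ r))) last-blocks<B+2)))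
    where q<C₂r = colex<C₂ z₂<z₁ (mirror-< k≤a a+1+z₁≡n)

  classify : ∀ {a b} → a < b → b < n → ∃ λ i → Region i a b
  classify {a} {b} a<b b<n with b <? k | k ≤? a
  ... | yes b<k | _       = 0 , left a<b b<k
  ... | no _    | yes k≤a = 3 , right (n ∸ suc a) (n ∸ suc b) k≤a (mirror-≡ (<-trans a<b b<n)) (mirror-≡ b<n)
                                      (∸-monoʳ-< (s≤s a<b) b<n)
  ... | no b≮k  | no a≱k with a + b <? k + k
  ...   | yes a+b<2k = 1 , crossEarly (s ∸ suc a) s a+1+u≡s s≤k b+s≡2k
    where
    s = k + k ∸ b
    a+1+u≡s : a + suc (s ∸ suc a) ≡ s
    a+1+u≡s = trans (+-suc a (s ∸ suc a)) (m+[n∸m]≡n (m+n≤o⇒m≤o∸n (suc a) a+b<2k))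
    s≤k : s ≤ k
    s≤k = ≤-trans (∸-monoʳ-≤ (k + k) (≮⇒≥ b≮k)) (≤-reflexive (m+n∸n≡m k k))
    b+s≡2k : b + s ≡ k + k
    b+s≡2k = m+[n∸m]≡n (≤-trans (m≤n+m b a) (<⇒≤ a+b<2k))
  ...   | no a+b≮2k = 2 , crossLate d (≰⇒> a≱k) d<a+ε a+b≡2k+d
    where
    d = a + b ∸ (k + k)
    a+b≡2k+d : a + b ≡ k + k + d
    a+b≡2k+d = sym (m+[n∸m]≡n (≮⇒≥ a+b≮2k))
    d<a+ε : d < a + ε
    d<a+ε = +-cancelˡ-< (k + k) d (a + ε) (begin-strict
      k + k + d      ≡⟨ sym a+b≡2k+d ⟩
      a + b          <⟨ +-monoʳ-< a b<n ⟩
      a + n          ≡⟨ regroup a k ε ⟩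
      k + k + (a + ε) ∎)
      where
      open ≤-Reasoning
      regroup : ∀ a k ε → a + (k + (k + ε)) ≡ k + k + (a + ε)
      regroup = solve-∀

  edgeRegion : (e : Edge n) → ∃ λ i → Region i (toℕ (src e)) (toℕ (tgt e))
  edgeRegion e = classify (proj₂ (proj₂ e)) (toℕ<n (tgt e))

  edgeLabel : Edge n → ℕ
  edgeLabel e = label (proj₂ (edgeRegion e))

  numbering : Edge n → ℤ
  numbering e = ℤ.+ edgeLabel e

  numbering-isEdgeNumbering : IsEdgeNumbering numbering
  numbering-isEdgeNumbering e e′ eq
    with label-injective (proj₂ (edgeRegion e)) (proj₂ (edgeRegion e′)) (ℤ.+-injective eq)
  ... | src≡ , tgt≡ = toℕ-injective src≡ , toℕ-injective tgt≡

  edgeLabel-window : ∀ (e : Edge n) {v} → HasEnd e v → Window (toℕ v) (edgeLabel e)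
  edgeLabel-window e (inj₁ refl) = window-src (proj₂ (edgeRegion e))
  edgeLabel-window e (inj₂ refl) = window-tgt (proj₂ (edgeRegion e))

  numbering-bandwidth : BandwidthAtMost numbering B
  numbering-bandwidth e e′ (_ , v , e∋v , e′∋v) = subst (_≤ B) (sym (∣+m-+n∣≡∣m-n∣ (edgeLabel e) (edgeLabel e′)))
    (∣m-n∣≤o (window-close (toℕ<n v) w w′) (window-close (toℕ<n v) w′ w))
    where
    w  = edgeLabel-window e e∋v
    w′ = edgeLabel-window e′ e′∋v

theorem13 : ∀ (n : ℕ) → 2 ≤ n → EdgeBandwidthKn n (formula n)
theorem13 n 2≤n with halves n
... | zero , ε , ε≤1 , refl = contradiction (≤-trans 2≤n ε≤1) λ { (s≤s ()) }
... | suc κ , ε , ε≤1 , refl rewrite formula-halves (suc κ) ε≤1 =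
    (numbering , numbering-isEdgeNumbering , numbering-bandwidth)
  , λ f f-numbering c f-bandwidth →
      m≤n+o⇒m∸n≤o _ 2 (lower-bound (suc κ) (κ + ε) refl 2≤n f f-numbering c f-bandwidth)
  where open Construction (suc κ) ε (s≤s z≤n) ε≤1
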